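{- There is an infinite chain of nested graded subspaces $$\mathbf{PQSym}^*=\mathbf{PQSym}^{*1}\supseteq\mathbf{PQSym}^{*2}\supseteq\dots\supseteq\mathbf{PQSym}^{*r}\supseteq\dots\supseteq\mathbf{PQSym}^{*\infty}.$$
   Context: Words are finite words on $\mathbb{N}\setminus\{0\}$. A word $u=u_1\dots u_n$ is a parking function if its nondecreasing rearrangement $u'$ satisfies $u'_i\le i$ for all $i$; prime if moreover $u'_i<i$ for $i\ge2$. Parkization: for $w$ of length $n$ let $d(w)=\min\{i\ge1:\#\{j:w_j\le i\}<i\}$; if $d(w)=n+1$ then $\mathrm{Park}(w)=w$, else $\mathrm{Park}(w)=\mathrm{Park}(w')$ with $w'$ obtained by decreasing by one every letter greater than $d(w)$. $\mathbf{PQSym}^*$ is the span over a field of characteristic $0$ of $\mathbf{G}_u=\sum_{\mathrm{Park}(w)=u}w$, $u$ parking function, graded by the length of $u$. $\mathrm{BW}$: infinite sequences of columns $(L_i,M_i)$, $L_i$ finite sets of positive integers whose nonempty members in order form a set composition of $[n]$, $M_i$ a prime parking function of length $|L_i|$. With $\|L\|=|L|$ for $L\ne\emptyset$, $\|\emptyset\|=1$, the bijection $\Phi:\mathrm{BW}\to$ words sends $m$ to $w$ with $w_p=(t\text{ -th letter of }M_j)+\sum_{q<j}\|L_q\|$ when $p$ is the $t$-th smallest element of $L_j$; words are identified with elements of $\mathrm{BW}$. For $r\in(\mathbb{N}\setminus\{0\})\cup\{\infty\}$, the $r$-action of $\mathfrak{S}_\infty=\langle s_i=(i,i+1)\rangle$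 on $\mathrm{BW}$ lets $s_i$ swap columns $i$ and $i+1$ if one of them has words of length strictly smaller than $r$, and fix the element otherwise; it is transported to words and extended linearly. $\mathbf{PQSym}^{*r}$ is the subspace of elements of $\mathbf{PQSym}^*$ invariant under the $r$-action. -}

module Defs where

open import Level using (Level; _⊔_)
open import Algebra.Bundles using (CommutativeRing)
open import Data.Nat as ℕ using (ℕ; zero; suc; _+_; _∸_; _≤_; _<_; _≤ᵇ_; _<ᵇ_; _≡ᵇ_)
open import Data.Bool using (Bool; true; false; if_then_else_; _∨_)
open import Data.List using (List; []; _∷_; _++_; length; map; filter; zip; upTo; replicate; concat)
open import Data.List.Relation.Unary.All using (All)
open import Data.List.Relation.Unary.Linked using (Linked)
open import Data.List.Relation.Binary.Permutation.Propositional using (_↭_)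
open import Data.Product using (_×_; Σ; proj₁; proj₂; _,_)
open import Data.Unit using (⊤)
open import Relation.Nullary using (¬_)
open import Relation.Binary.PropositionalEquality using (_≡_)
open import Data.Nat.ListAction using (sum)

record Field (c ℓ : Level) : Set (Level.suc (c ⊔ ℓ)) where
  field
    baseRing : CommutativeRing c ℓ
  open CommutativeRing baseRing public
  field
    1≉0     : ¬ (1# ≈ 0#)
    inverse : ∀ x → ¬ (x ≈ 0#) → Σ Carrier λ y → (x * y) ≈ 1#

module _ {c ℓ} (K : Field c ℓ) where
  open Field K using (Carrier; 0#; 1#; _≈_) renaming (_+_ to _+K_)
  natCast : ℕ → Carrier
  natCast zero    = 0#
  natCast (suc n) = 1# +K natCast n

  CharZero : Set ℓ
  CharZero = ∀ n → ¬ (natCast (suc n) ≈ 0#)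

Word : Set
Word = List ℕ

insert : ℕ → Word → Word
insert x []       = x ∷ []
insert x (y ∷ ys) = if x ≤ᵇ y then x ∷ y ∷ ys else y ∷ insert x ys

sortW : Word → Word
sortW []       = []
sortW (x ∷ xs) = insert x (sortW xs)

-- u'_i ≤ i for i ≥ k (k = index of the head)
ParkChk : ℕ → Word → Set
ParkChk k []       = ⊤
ParkChk k (x ∷ xs) = x ≤ k × ParkChk (suc k) xs

IsParking : Word → Set
IsParking u = All (1 ≤_) u × ParkChk 1 (sortW u)

-- u'_1 ≤ 1 and u'_i < i for i ≥ 2
PrimeChk : ℕ → Word → Set
PrimeChk k []       = ⊤
PrimeChk k (x ∷ xs) = x < k × PrimeChk (suc k) xs

IsPrimeParking : Word → Set
IsPrimeParking u = IsParking u × PrimeChk 2 (ParkTail (sortW u))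
  where
  ParkTail : Word → Word
  ParkTail []       = []
  ParkTail (_ ∷ xs) = xs

count≤ : ℕ → Word → ℕ
count≤ i w = length (filter (λ x → x ℕ.≤? i) w)

-- d(w) = min { i ≥ 1 : #{j : w_j ≤ i} < i }, searched in i, i+1, ...,
-- with fuel; for fuel = length w + 1 starting from i = 1 the minimum
-- is always found (it is ≤ n+1).
dSearch : ℕ → ℕ → Word → ℕ
dSearch zero       i w = i
dSearch (suc fuel) i w = if count≤ i w <ᵇ i then i else dSearch fuel (suc i) w

d : Word → ℕ
d w = dSearch (length w) 1 w

lower : ℕ → Word → Word
lower e w = map (λ x → if e <ᵇ x then x ∸ 1 else x) w

-- recursion with fuel; each non-final step strictly decreases the sum of
-- the letters, so fuel = sum w + 1 is always sufficient.
parkF : ℕ → Word → Word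
parkF zero       w = w
parkF (suc fuel) w =
  if d w ≡ᵇ suc (length w) then w else parkF fuel (lower (d w) w)

Park : Word → Word
Park w = parkF (suc (sum w)) w

-- A column is (L , M) with L a finite set of positive
-- integers, represented as a strictly increasing list, and M a word.
-- An element of BW is an infinite sequence of columns all but finitely
-- many of which are (∅ , ε); it is represented by a finite list of
-- columns, implicitly padded with infinitely many empty columns.

Col : Set
Col = List ℕ × Word

emptyCol : Col
emptyCol = [] , []

ValidCol : Col → Set
ValidCol (L , M) =
  All (1 ≤_) L × Linked _<_ L × IsPrimeParking M × length M ≡ length L

range1 : ℕ → List ℕ
range1 n = map suc (upTo n)

-- m ∈ BW of size n: columns valid, nonempty L's form a set composition of [n]
ValidBW : ℕ → List Col → Set
ValidBW n cs = All ValidCol cs × (concat (map proj₁ cs) ↭ range1 n)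

norm : List ℕ → ℕ
norm []      = 1
norm (x ∷ L) = length (x ∷ L)

-- (position , letter) pairs produced by Φ, offset = Σ_{q<j} ‖L_q‖
phiPairs : ℕ → List Col → List (ℕ × ℕ)
phiPairs o []             = []
phiPairs o ((L , M) ∷ cs) = zip L (map (o +_) M) ++ phiPairs (o + norm L) cs

lookupPos : ℕ → List (ℕ × ℕ) → ℕ
lookupPos p []             = 0
lookupPos p ((q , x) ∷ ps) = if p ≡ᵇ q then x else lookupPos p ps

Φ : ℕ → List Col → Word
Φ n cs = map (λ p → lookupPos p (phiPairs 0 cs)) (range1 n)

data Rank : Set where
  fin : ℕ → Rank
  ∞   : Rank

_<ᴿ_ : ℕ → Rank → Bool
k <ᴿ fin r = k <ᵇ r
k <ᴿ ∞     = true

-- swap columns at 0-based positions i, i+1 if one of them has words of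
-- length < r
swapIf : Rank → ℕ → List Col → List Col
swapIf r zero    (a ∷ b ∷ cs) =
  if (length (proj₂ a) <ᴿ r) ∨ (length (proj₂ b) <ᴿ r)
  then b ∷ a ∷ cs else a ∷ b ∷ cs
swapIf r (suc i) (a ∷ cs) = a ∷ swapIf r i cs
swapIf r _       cs       = cs

-- pad with empty columns so that positions i, i+1 exist
pad : ℕ → List Col → List Col
pad i cs = cs ++ replicate (suc (suc i) ∸ length cs) emptyCol

-- action of s_{i+1} = (i+1, i+2) (columns indexed from 1 in the paper)
act : Rank → ℕ → List Col → List Col
act r i cs = swapIf r i (pad i cs)

-- A homogeneous element of degree n is Σ_u c(u) G_u, the sum
-- over parking functions u of length n, given by coefficients c; its
-- coefficient on a word w of length n is c(Park w).
-- It is invariant under the r-action iff for every generator s_i and every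
-- word w, coeff(s_i · w) = coeff(w); since Φ is a bijection, writing
-- w = Φ(m) this reads:

module _ {c ℓ} (K : Field c ℓ) where
  open Field K using (Carrier; _≈_)

  InPQSymr : Rank → (n : ℕ) → (Word → Carrier) → Set ℓ
  InPQSymr r n coef =
    ∀ (m : List Col) → ValidBW n m → ∀ (i : ℕ) →
      coef (Park (Φ n (act r i m))) ≈ coef (Park (Φ n m))

-- The swap rule only asks whether a column is short. So if every length that is short
-- for r is short for r', each s_i acts under r either exactly as under r' or trivially,
-- and r'-invariance implies r-invariance: PQSym*∞ ⊆ PQSym*(r+1) ⊆ PQSym*r.
-- The real content is PQSym*1 = PQSym*. The 1-action only moves empty columns, while
-- Park(Φ(m)) is Φ of m with its empty columns deleted. Indeed, let s be the total size
-- of the columns before the first empty column that precedes a nonempty one. Those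
-- columns are shifted parking functions, so at least j letters of Φ(m) are ≤ j for
-- j ≤ s, while all later letters exceed s + 1; hence d = s + 1, and lowering the
-- letters above s + 1 deletes that empty column. Without such a column d = n + 1 and
-- Φ(m) is already parkized.
module Submission where

open import Defs
open import Level using (Level)
open import Data.Nat using (ℕ; suc; _≤_)
open import Data.Product using (_×_)

open import Data.Bool using (true; false; T; _∨_; if_then_else_)
open import Data.Bool.Properties using (T-≡)
open import Data.List using (List; []; _∷_; _++_; length; map; filter; zip; concat; replicate; upTo)
open import Data.List.Properties
  using (map-++; concat-++; length-++; length-map; length-upTo; map-∘; map-cong; map-cong-local;
         ++-assoc; ++-identityʳ; filter-++; filter-all; filter-accept; filter-reject; filter-none; length-filter)
open import Data.List.Relation.Unary.All as All using (All; []; _∷_)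
import Data.List.Relation.Unary.All.Properties as All
open import Data.List.Relation.Unary.Any as Any using (Any; here; there)
import Data.List.Relation.Unary.Any.Properties as Any
open import Data.List.Relation.Unary.AllPairs using (_∷_)
open import Data.List.Relation.Unary.Unique.Propositional using (Unique)
import Data.List.Relation.Unary.Unique.Propositional.Properties as Unique
open import Data.List.Relation.Binary.Permutation.Propositional
  using (_↭_; ↭-sym; ↭-trans; ↭⇒↭ₛ) renaming (refl to ↭-refl; prep to ↭-prep; swap to ↭-swap)
open import Data.List.Relation.Binary.Permutation.Propositional.Properties
  using (↭-length; All-resp-↭; Any-resp-↭; filter-↭; map⁺)
open import Data.List.Relation.Binary.Permutation.Setoid.Properties as Permutationₛ using ()
open import Data.Nat using (zero; _+_; _∸_; _<_; _<ᵇ_; _≤ᵇ_; _≡ᵇ_; z≤n; s≤s; _≤?_)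
open import Data.Nat.ListAction using (sum)
open import Data.Nat.Properties
open import Data.Product using (proj₁; proj₂; _,_; map₂)
open import Data.Sum using (_⊎_; inj₁; inj₂)
open import Function using (_∘_; Equivalence)
open import Relation.Nullary using (¬_; yes; no; contradiction)
open import Relation.Unary using (Decidable)
open import Relation.Binary.PropositionalEquality

private
  variable
    i j : ℕ
    x : ℕ
    xs ys : List ℕ

≡ᵇ-refl : ∀ m → (m ≡ᵇ m) ≡ true
≡ᵇ-refl m = Equivalence.to T-≡ (≡⇒≡ᵇ m m refl)

≢⇒≡ᵇ-false : ∀ m n → m ≢ n → (m ≡ᵇ n) ≡ false
≢⇒≡ᵇ-false m n m≢n with m ≡ᵇ n in eq
... | true  = contradiction (≡ᵇ⇒≡ m n (subst T (sym eq) _)) m≢n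
... | false = refl

<⇒<ᵇ-true : ∀ {m n} → m < n → (m <ᵇ n) ≡ true
<⇒<ᵇ-true m<n = Equivalence.to T-≡ (<⇒<ᵇ m<n)

≮⇒<ᵇ-false : ∀ m n → ¬ (m < n) → (m <ᵇ n) ≡ false
≮⇒<ᵇ-false m n m≮n with m <ᵇ n in eq
... | true  = contradiction (<ᵇ⇒< m n (subst T (sym eq) _)) m≮n
... | false = refl

count≤-accept : x ≤ i → count≤ i (x ∷ xs) ≡ suc (count≤ i xs)
count≤-accept {i = i} = cong length ∘ filter-accept (_≤? i)

count≤-reject : ¬ (x ≤ i) → count≤ i (x ∷ xs) ≡ count≤ i xs
count≤-reject {i = i} = cong length ∘ filter-reject (_≤? i)

count≤-++ : ∀ i xs ys → count≤ i (xs ++ ys) ≡ count≤ i xs + count≤ i ys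
count≤-++ i xs ys = trans (cong length (filter-++ (_≤? i) xs ys)) (length-++ (filter (_≤? i) xs))

count≤-↭ : ∀ i → xs ↭ ys → count≤ i xs ≡ count≤ i ys
count≤-↭ i p = ↭-length (filter-↭ (_≤? i) p)

count≤-≤-length : ∀ i xs → count≤ i xs ≤ length xs
count≤-≤-length i = length-filter (_≤? i)

count≤-all-> : All (i <_) xs → count≤ i xs ≡ 0
count≤-all-> {i} ps = cong length (filter-none (_≤? i) (All.map <⇒≱ ps))

count≤-mono : ∀ xs → i ≤ j → count≤ i xs ≤ count≤ j xs
count≤-mono [] _ = z≤n
count≤-mono {i} {j} (x ∷ xs) i≤j with x ≤? i | x ≤? j
... | yes x≤i | yes x≤j rewrite count≤-accept {xs = xs} x≤i | count≤-accept {xs = xs} x≤j =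
  s≤s (count≤-mono xs i≤j)
... | yes x≤i | no x≰j = contradiction (≤-trans x≤i i≤j) x≰j
... | no x≰i  | yes x≤j rewrite count≤-reject {xs = xs} x≰i | count≤-accept {xs = xs} x≤j =
  m≤n⇒m≤1+n (count≤-mono xs i≤j)
... | no x≰i  | no x≰j rewrite count≤-reject {xs = xs} x≰i | count≤-reject {xs = xs} x≰j =
  count≤-mono xs i≤j

count≤-shift : ∀ o i xs → count≤ (o + i) (map (o +_) xs) ≡ count≤ i xs
count≤-shift o i [] = refl
count≤-shift o i (x ∷ xs) with x ≤? i
... | yes x≤i = trans (count≤-accept (+-monoʳ-≤ o x≤i)) (trans (cong suc (count≤-shift o i xs)) (sym (count≤-accept x≤i)))
... | no x≰i  = trans (count≤-reject (x≰i ∘ +-cancelˡ-≤ o x i)) (trans (count≤-shift o i xs) (sym (count≤-reject x≰i)))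

-- Parking functions

insert-↭ : ∀ x xs → insert x xs ↭ x ∷ xs
insert-↭ x [] = ↭-refl
insert-↭ x (y ∷ ys) with x ≤ᵇ y
... | true  = ↭-refl
... | false = ↭-trans (↭-prep y (insert-↭ x ys)) (↭-swap y x ↭-refl)

sortW-↭ : ∀ xs → sortW xs ↭ xs
sortW-↭ [] = ↭-refl
sortW-↭ (x ∷ xs) = ↭-trans (insert-↭ x (sortW xs)) (↭-prep x (sortW-↭ xs))

ParkChk-count≤ : ∀ a xs t → ParkChk (suc a) xs → t ≤ length xs → t ≤ count≤ (a + t) xs
ParkChk-count≤ a xs zero _ _ = z≤n
ParkChk-count≤ a (x ∷ xs) (suc t) (x≤1+a , chk) (s≤s t≤n) =
  subst (suc t ≤_) (sym (count≤-accept x≤a+1+t)) (s≤s (subst (λ k → t ≤ count≤ k xs) a+1+t≡ rec))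
  where
  a+1+t≡ : suc a + t ≡ a + suc t
  a+1+t≡ = sym (+-suc a t)
  x≤a+1+t : x ≤ a + suc t
  x≤a+1+t = ≤-trans x≤1+a (subst (suc a ≤_) a+1+t≡ (m≤m+n (suc a) t))
  rec : t ≤ count≤ (suc a + t) xs
  rec = ParkChk-count≤ (suc a) xs t chk t≤n

ParkChk-bound : ∀ k xs → ParkChk k xs → All (_< k + length xs) xs
ParkChk-bound k [] _ = []
ParkChk-bound k (x ∷ xs) (x≤k , chk) =
  ≤-<-trans x≤k k<k+1+n ∷ All.map (λ {y} → subst (y <_) (sym (+-suc k (length xs)))) (ParkChk-bound (suc k) xs chk)
  where
  k<k+1+n : k < k + suc (length xs)
  k<k+1+n = m<m+n k (s≤s z≤n)

parking-count≤ : ∀ M t → IsParking M → t ≤ length M → t ≤ count≤ t M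
parking-count≤ M t (_ , chk) t≤n =
  subst (t ≤_) (count≤-↭ t (sortW-↭ M))
    (ParkChk-count≤ 0 (sortW M) t chk (subst (t ≤_) (sym (↭-length (sortW-↭ M))) t≤n))

parking-bound : ∀ M → IsParking M → All (_≤ length M) M
parking-bound M (_ , chk) =
  All.map (λ {y} y<1+n → ≤-pred (subst (λ k → y < suc k) (↭-length (sortW-↭ M)) y<1+n))
    (All-resp-↭ (sortW-↭ M) (ParkChk-bound 1 (sortW M) chk))

map-proj₁-zip : ∀ {A B : Set} (xs : List A) (ys : List B) → length ys ≡ length xs → map proj₁ (zip xs ys) ≡ xs
map-proj₁-zip [] ys _ = refl
map-proj₁-zip (x ∷ xs) (y ∷ ys) eq = cong (x ∷_) (map-proj₁-zip xs ys (suc-injective eq))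

map-proj₂-zip : ∀ {A B : Set} (xs : List A) (ys : List B) → length ys ≡ length xs → map proj₂ (zip xs ys) ≡ ys
map-proj₂-zip [] [] _ = refl
map-proj₂-zip (x ∷ xs) (y ∷ ys) eq = cong (y ∷_) (map-proj₂-zip xs ys (suc-injective eq))

map-map₂-zip : ∀ {A B C : Set} (f : B → C) (xs : List A) (ys : List B) → map (map₂ f) (zip xs ys) ≡ zip xs (map f ys)
map-map₂-zip f [] ys = refl
map-map₂-zip f (x ∷ xs) [] = refl
map-map₂-zip f (x ∷ xs) (y ∷ ys) = cong ((x , f y) ∷_) (map-map₂-zip f xs ys)

readWord : ℕ → List (ℕ × ℕ) → Word
readWord n ps = map (λ p → lookupPos p ps) (range1 n)

length-range1 : ∀ n → length (range1 n) ≡ n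
length-range1 n = trans (length-map suc (upTo n)) (length-upTo n)

length-readWord : ∀ n ps → length (readWord n ps) ≡ n
length-readWord n ps = trans (length-map _ (range1 n)) (length-range1 n)

lookupPos-keys : ∀ ps → Unique (map proj₁ ps) → map (λ p → lookupPos p ps) (map proj₁ ps) ≡ map proj₂ ps
lookupPos-keys [] _ = refl
lookupPos-keys ((q , x) ∷ ps) (q∉ps ∷ u) rewrite ≡ᵇ-refl q =
  cong (x ∷_) (trans (map-cong-local (All.map skip q∉ps)) (lookupPos-keys ps u))
  where
  skip : ∀ {p} → q ≢ p → lookupPos p ((q , x) ∷ ps) ≡ lookupPos p ps
  skip {p} q≢p rewrite ≢⇒≡ᵇ-false p q (q≢p ∘ sym) = refl

lookupPos-map₂ : ∀ (f : ℕ → ℕ) → f 0 ≡ 0 → ∀ p ps → lookupPos p (map (map₂ f) ps) ≡ f (lookupPos p ps)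
lookupPos-map₂ f f0≡0 p [] = sym f0≡0
lookupPos-map₂ f f0≡0 p ((q , x) ∷ ps) with p ≡ᵇ q
... | true  = refl
... | false = lookupPos-map₂ f f0≡0 p ps

readWord-↭ : ∀ n ps → map proj₁ ps ↭ range1 n → readWord n ps ↭ map proj₂ ps
readWord-↭ n ps keys↭ =
  subst (readWord n ps ↭_) (lookupPos-keys ps distinct) (map⁺ (λ p → lookupPos p ps) (↭-sym keys↭))
  where
  distinct : Unique (map proj₁ ps)
  distinct = Permutationₛ.Unique-resp-↭ (setoid ℕ) (↭⇒↭ₛ (↭-sym keys↭))
               (Unique.map⁺ suc-injective (Unique.upTo⁺ n))

WellFormedCol : Col → Set
WellFormedCol (L , M) = IsParking M × length M ≡ length L

data NonEmptyCol : Col → Set where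
  nonEmpty : ∀ {p L M} → NonEmptyCol (p ∷ L , M)

nonEmptyCol? : Decidable NonEmptyCol
nonEmptyCol? ([] , M)    = no λ ()
nonEmptyCol? (p ∷ L , M) = yes nonEmpty

dropEmpty : List Col → List Col
dropEmpty = filter nonEmptyCol?

positions : List Col → List ℕ
positions cs = concat (map proj₁ cs)

positions-++ : ∀ A B → positions (A ++ B) ≡ positions A ++ positions B
positions-++ A B = trans (cong concat (map-++ proj₁ A B)) (sym (concat-++ (map proj₁ A) (map proj₁ B)))

positions-dropEmpty : ∀ cs → positions (dropEmpty cs) ≡ positions cs
positions-dropEmpty [] = refl
positions-dropEmpty (([] , M) ∷ cs)    = positions-dropEmpty cs
positions-dropEmpty ((p ∷ L , M) ∷ cs) = cong ((p ∷ L) ++_) (positions-dropEmpty cs)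

positions-empty : ∀ B → All (¬_ ∘ NonEmptyCol) B → positions B ≡ []
positions-empty [] _ = refl
positions-empty (([] , M) ∷ B) (_ ∷ empty) = positions-empty B empty
positions-empty ((p ∷ L , M) ∷ B) (¬ne ∷ _) = contradiction nonEmpty ¬ne

size : List Col → ℕ
size cs = length (positions cs)

size-++ : ∀ A B → size (A ++ B) ≡ size A + size B
size-++ A B = trans (cong length (positions-++ A B)) (length-++ (positions A))

length≤norm : ∀ L → length L ≤ norm L
length≤norm [] = z≤n
length≤norm (_ ∷ _) = ≤-refl

width : List Col → ℕ
width [] = 0
width ((L , M) ∷ cs) = norm L + width cs

width-nonEmpty : ∀ A → All NonEmptyCol A → width A ≡ size A
width-nonEmpty [] _ = refl
width-nonEmpty ((p ∷ L , M) ∷ A) (nonEmpty ∷ ne) =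
  trans (cong (suc (length L) +_) (width-nonEmpty A ne)) (sym (length-++ (p ∷ L)))

phiPairs-++ : ∀ o A B → phiPairs o (A ++ B) ≡ phiPairs o A ++ phiPairs (o + width A) B
phiPairs-++ o [] B = cong (λ o′ → phiPairs o′ B) (sym (+-identityʳ o))
phiPairs-++ o ((L , M) ∷ A) B = begin
  zip L (map (o +_) M) ++ phiPairs (o + norm L) (A ++ B)
    ≡⟨ cong (zip L (map (o +_) M) ++_) (phiPairs-++ (o + norm L) A B) ⟩
  zip L (map (o +_) M) ++ (phiPairs (o + norm L) A ++ phiPairs (o + norm L + width A) B)
    ≡⟨ sym (++-assoc (zip L (map (o +_) M)) _ _) ⟩
  (zip L (map (o +_) M) ++ phiPairs (o + norm L) A) ++ phiPairs (o + norm L + width A) B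
    ≡⟨ cong (λ o′ → phiPairs o ((L , M) ∷ A) ++ phiPairs o′ B) (+-assoc o (norm L) (width A)) ⟩
  phiPairs o ((L , M) ∷ A) ++ phiPairs (o + width ((L , M) ∷ A)) B ∎
  where open ≡-Reasoning

phiPairs-empty : ∀ o B → All (¬_ ∘ NonEmptyCol) B → phiPairs o B ≡ []
phiPairs-empty o [] _ = refl
phiPairs-empty o (([] , M) ∷ B) (_ ∷ empty) = phiPairs-empty (o + 1) B empty
phiPairs-empty o ((p ∷ L , M) ∷ B) (¬ne ∷ _) = contradiction nonEmpty ¬ne

dropEmpty-++-empty : ∀ A B → All (¬_ ∘ NonEmptyCol) B → dropEmpty (A ++ B) ≡ dropEmpty A
dropEmpty-++-empty A B empty =
  trans (filter-++ nonEmptyCol? A B) (trans (cong (dropEmpty A ++_) (filter-none nonEmptyCol? empty)) (++-identityʳ _))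

Φ-++-empty : ∀ n A B → All (¬_ ∘ NonEmptyCol) B → Φ n (A ++ B) ≡ Φ n A
Φ-++-empty n A B empty = cong (readWord n)
  (trans (phiPairs-++ 0 A B) (trans (cong (phiPairs 0 A ++_) (phiPairs-empty _ B empty)) (++-identityʳ _)))

phiPairs-keys : ∀ o cs → All WellFormedCol cs → map proj₁ (phiPairs o cs) ≡ positions cs
phiPairs-keys o [] _ = refl
phiPairs-keys o ((L , M) ∷ cs) ((_ , len) ∷ wf) =
  trans (map-++ proj₁ (zip L (map (o +_) M)) _)
    (cong₂ _++_ (map-proj₁-zip L _ (trans (length-map (o +_) M) len)) (phiPairs-keys (o + norm L) cs wf))

letters : ℕ → List Col → List ℕ
letters o cs = map proj₂ (phiPairs o cs)

letters-∷ : ∀ o L M cs → length M ≡ length L →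
            letters o ((L , M) ∷ cs) ≡ map (o +_) M ++ letters (o + norm L) cs
letters-∷ o L M cs len =
  trans (map-++ proj₂ (zip L (map (o +_) M)) _)
    (cong (_++ letters (o + norm L) cs) (map-proj₂-zip L _ (trans (length-map (o +_) M) len)))

letters-++ : ∀ o A B → letters o (A ++ B) ≡ letters o A ++ letters (o + width A) B
letters-++ o A B = trans (cong (map proj₂) (phiPairs-++ o A B)) (map-++ proj₂ (phiPairs o A) _)

length-letters : ∀ o cs → All WellFormedCol cs → length (letters o cs) ≡ size cs
length-letters o cs wf = begin
  length (map proj₂ (phiPairs o cs)) ≡⟨ length-map proj₂ (phiPairs o cs) ⟩
  length (phiPairs o cs)             ≡⟨ sym (length-map proj₁ (phiPairs o cs)) ⟩
  length (map proj₁ (phiPairs o cs)) ≡⟨ cong length (phiPairs-keys o cs wf) ⟩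
  size cs                            ∎
  where open ≡-Reasoning

letters-> : ∀ o cs → All WellFormedCol cs → All (o <_) (letters o cs)
letters-> o [] _ = []
letters-> o ((L , M) ∷ cs) (((positive , _) , len) ∷ wf) rewrite letters-∷ o L M cs len =
  All.++⁺ (All.map⁺ (All.map (λ {x} 1≤x → subst (_≤ o + x) (+-comm o 1) (+-monoʳ-≤ o 1≤x)) positive))
          (All.map (≤-<-trans (m≤m+n o (norm L))) (letters-> (o + norm L) cs wf))

letters-≤ : ∀ o cs → All WellFormedCol cs → All (_≤ o + width cs) (letters o cs)
letters-≤ o [] _ = []
letters-≤ o ((L , M) ∷ cs) ((park , len) ∷ wf) rewrite letters-∷ o L M cs len =
  All.++⁺ (All.map⁺ (All.map (+-monoʳ-≤ o ∘ bound) (parking-bound M park)))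
          (All.map (λ {x} → subst (x ≤_) (+-assoc o (norm L) (width cs))) (letters-≤ (o + norm L) cs wf))
  where
  bound : ∀ {x} → x ≤ length M → x ≤ norm L + width cs
  bound x≤m = ≤-trans x≤m (≤-trans (≤-reflexive len) (≤-trans (length≤norm L) (m≤m+n (norm L) (width cs))))

letters-Any-> : ∀ o B → All WellFormedCol B → Any NonEmptyCol B → Any (o <_) (letters o B)
letters-Any-> o ((p ∷ L , []) ∷ B) ((_ , ()) ∷ _) (here nonEmpty)
letters-Any-> o ((p ∷ L , y ∷ M) ∷ B) wf (here nonEmpty) = here (All.head (letters-> o _ wf))
letters-Any-> o ((L , M) ∷ B) ((_ , len) ∷ wf) (there ne) rewrite letters-∷ o L M B len =
  Any.++⁺ʳ (map (o +_) M) (Any.map (≤-<-trans (m≤m+n o (norm L))) (letters-Any-> (o + norm L) B wf ne))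

column-count≤ : ∀ o M t → IsParking M → t ≤ length M → t ≤ count≤ (o + t) (map (o +_) M)
column-count≤ o M t park t≤m = subst (t ≤_) (sym (count≤-shift o t M)) (parking-count≤ M t park t≤m)

-- Up to its size, a run of nonempty columns behaves like one parking function.
letters-count≤ : ∀ o A → All NonEmptyCol A → All WellFormedCol A →
                 ∀ t → t ≤ size A → t ≤ count≤ (o + t) (letters o A)
letters-count≤ o [] _ _ zero _ = z≤n
letters-count≤ o ((p ∷ L , M) ∷ A) (nonEmpty ∷ ne) ((park , len) ∷ wf) t t≤size
  rewrite letters-∷ o (p ∷ L) M A len | count≤-++ (o + t) (map (o +_) M) (letters (o + suc (length L)) A)
  with t ≤? suc (length L)
... | yes t≤k = ≤-trans (column-count≤ o M t park (subst (t ≤_) (sym len) t≤k)) (m≤m+n _ _)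
... | no t≰k = ≤-trans (≤-reflexive (sym (m+[n∸m]≡n k≤t))) (+-mono-≤ full rest)
  where
  k : ℕ
  k = suc (length L)
  k≤t : k ≤ t
  k≤t = ≰⇒≥ t≰k
  full : k ≤ count≤ (o + t) (map (o +_) M)
  full = ≤-trans (column-count≤ o M k park (≤-reflexive (sym len))) (count≤-mono (map (o +_) M) (+-monoʳ-≤ o k≤t))
  rest : t ∸ k ≤ count≤ (o + t) (letters (o + k) A)
  rest = subst (λ m → t ∸ k ≤ count≤ m (letters (o + k) A))
           (trans (+-assoc o k (t ∸ k)) (cong (o +_) (m+[n∸m]≡n k≤t)))
           (letters-count≤ (o + k) A ne wf (t ∸ k)
             (subst (t ∸ k ≤_) (m+n∸m≡n k (size A)) (∸-monoˡ-≤ k (subst (t ≤_) (length-++ (p ∷ L)) t≤size))))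

Φ-↭-letters : ∀ n cs → All WellFormedCol cs → positions cs ↭ range1 n → Φ n cs ↭ letters 0 cs
Φ-↭-letters n cs wf pos↭ =
  readWord-↭ n (phiPairs 0 cs) (subst (_↭ range1 n) (sym (phiPairs-keys 0 cs wf)) pos↭)

Φ-count≤ : ∀ n A R → All NonEmptyCol A → All WellFormedCol (A ++ R) → positions (A ++ R) ↭ range1 n →
           ∀ j → j ≤ size A → j ≤ count≤ j (Φ n (A ++ R))
Φ-count≤ n A R ne wf pos↭ j j≤size = begin
  j                                                      ≤⟨ letters-count≤ 0 A ne (All.++⁻ˡ A wf) j j≤size ⟩
  count≤ j (letters 0 A)                                 ≤⟨ m≤m+n _ _ ⟩
  count≤ j (letters 0 A) + count≤ j (letters (width A) R) ≡⟨ sym (count≤-++ j (letters 0 A) _) ⟩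
  count≤ j (letters 0 A ++ letters (width A) R)           ≡⟨ cong (count≤ j) (sym (letters-++ 0 A R)) ⟩
  count≤ j (letters 0 (A ++ R))                          ≡⟨ sym (count≤-↭ j (Φ-↭-letters n (A ++ R) wf pos↭)) ⟩
  count≤ j (Φ n (A ++ R))                                ∎
  where open ≤-Reasoning

-- Parkization of Φ(m)

dSearch-first : ∀ fuel i k w → k ≤ fuel →
                (∀ j → i ≤ j → j < i + k → j ≤ count≤ j w) →
                (k < fuel → count≤ (i + k) w < i + k) →
                dSearch fuel i w ≡ i + k
dSearch-first zero i zero w _ _ _ = sym (+-identityʳ i)
dSearch-first (suc f) i zero w _ _ fails
  rewrite <⇒<ᵇ-true (subst (λ m → count≤ m w < m) (+-identityʳ i) (fails (s≤s z≤n))) = sym (+-identityʳ i)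
dSearch-first (suc f) i (suc k) w (s≤s k≤f) passes fails
  rewrite ≮⇒<ᵇ-false (count≤ i w) i (≤⇒≯ (passes i ≤-refl (m<m+n i (s≤s z≤n)))) =
  trans (dSearch-first f (suc i) k w k≤f passes′ fails′) (sym (+-suc i k))
  where
  passes′ : ∀ j → suc i ≤ j → j < suc i + k → j ≤ count≤ j w
  passes′ j i<j j<1+i+k = passes j (<⇒≤ i<j) (subst (j <_) (sym (+-suc i k)) j<1+i+k)
  fails′ : k < f → count≤ (suc i + k) w < suc i + k
  fails′ k<f = subst (λ m → count≤ m w < m) (+-suc i k) (fails (s≤s k<f))

d≡suc : ∀ w k → k ≤ length w →
        (∀ j → 1 ≤ j → j ≤ k → j ≤ count≤ j w) →
        (k < length w → count≤ (suc k) w < suc k) →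
        d w ≡ suc k
d≡suc w k k≤n passes = dSearch-first (length w) 1 k w k≤n (λ j 1≤j j<1+k → passes j 1≤j (≤-pred j<1+k))

parkF-done : ∀ f w → d w ≡ suc (length w) → parkF (suc f) w ≡ w
parkF-done f w d≡ rewrite d≡ | ≡ᵇ-refl (suc (length w)) = refl

parkF-step : ∀ f w → d w ≢ suc (length w) → parkF (suc f) w ≡ parkF f (lower (d w) w)
parkF-step f w d≢ rewrite ≢⇒≡ᵇ-false (d w) (suc (length w)) d≢ = refl

lowerLetter : ℕ → ℕ → ℕ
lowerLetter e x = if e <ᵇ x then x ∸ 1 else x

lowerLetter-≤ : ∀ e x → lowerLetter e x ≤ x
lowerLetter-≤ e x with e <ᵇ x
... | true  = m∸n≤m x 1
... | false = ≤-refl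

lowerLetter-< : ∀ e x → e < x → lowerLetter e x < x
lowerLetter-< e (suc x) e<x rewrite <⇒<ᵇ-true e<x = ≤-refl

sum-lower-≤ : ∀ e w → sum (lower e w) ≤ sum w
sum-lower-≤ e [] = z≤n
sum-lower-≤ e (x ∷ w) = +-mono-≤ (lowerLetter-≤ e x) (sum-lower-≤ e w)

sum-lower-< : ∀ e w → Any (e <_) w → sum (lower e w) < sum w
sum-lower-< e (x ∷ w) (here e<x) = +-mono-<-≤ (lowerLetter-< e x e<x) (sum-lower-≤ e w)
sum-lower-< e (x ∷ w) (there any) = +-mono-≤-< (lowerLetter-≤ e x) (sum-lower-< e w any)

lower-readWord : ∀ e n ps → lower e (readWord n ps) ≡ readWord n (map (map₂ (lowerLetter e)) ps)
lower-readWord e n ps = trans (sym (map-∘ (range1 n)))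
  (map-cong (λ p → sym (lookupPos-map₂ (lowerLetter e) refl p ps)) (range1 n))

lowering-below : ∀ e (ps : List (ℕ × ℕ)) → All (_≤ e) (map proj₂ ps) → map (map₂ (lowerLetter e)) ps ≡ ps
lowering-below e [] _ = refl
lowering-below e ((p , x) ∷ ps) (x≤e ∷ below) rewrite ≮⇒<ᵇ-false e x (≤⇒≯ x≤e) =
  cong ((p , x) ∷_) (lowering-below e ps below)

lowering-above : ∀ e o B → e ≤ suc o → All WellFormedCol B →
                 map (map₂ (lowerLetter e)) (phiPairs (suc o) B) ≡ phiPairs o B
lowering-above e o [] _ _ = refl
lowering-above e o ((L , M) ∷ B) e≤1+o (((positive , _) , _) ∷ wf) =
  trans (map-++ _ (zip L (map (suc o +_) M)) _)
    (cong₂ _++_ (trans (map-map₂-zip (lowerLetter e) L _) (cong (zip L) (trans (sym (map-∘ M)) (map-cong-local (All.map shift positive)))))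
                (lowering-above e (o + norm L) B (≤-trans e≤1+o (s≤s (m≤m+n o (norm L)))) wf))
  where
  shift : ∀ {x} → 1 ≤ x → lowerLetter e (suc o + x) ≡ o + x
  shift {suc x} _ rewrite <⇒<ᵇ-true {e} {suc (o + suc x)} (≤-<-trans e≤1+o (s≤s (m<m+n o (s≤s z≤n)))) = refl

data FirstGap : List Col → Set where
  noGap : ∀ A B → All NonEmptyCol A → All (¬_ ∘ NonEmptyCol) B → FirstGap (A ++ B)
  gapAt : ∀ A B → All NonEmptyCol A → Any NonEmptyCol B → FirstGap (A ++ emptyCol ∷ B)

firstGap : ∀ cs → All WellFormedCol cs → FirstGap cs
firstGap [] _ = noGap [] [] [] []
firstGap ((p ∷ L , M) ∷ cs) (_ ∷ wf) with firstGap cs wf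
... | noGap A B ne empty = noGap ((p ∷ L , M) ∷ A) B (nonEmpty ∷ ne) empty
... | gapAt A B ne ne′  = gapAt ((p ∷ L , M) ∷ A) B (nonEmpty ∷ ne) ne′
firstGap (([] , []) ∷ cs) _ with Any.any? nonEmptyCol? cs
... | yes ne′ = gapAt [] cs [] ne′
... | no ¬ne′ = noGap [] (emptyCol ∷ cs) [] ((λ ()) ∷ All.¬Any⇒All¬ cs ¬ne′)
firstGap (([] , _ ∷ _) ∷ cs) ((_ , ()) ∷ _)

size-range1 : ∀ cs n → positions cs ↭ range1 n → size cs ≡ n
size-range1 cs n pos↭ = trans (↭-length pos↭) (length-range1 n)

size-Any : ∀ B → Any NonEmptyCol B → 0 < size B
size-Any ((p ∷ L , M) ∷ B) (here nonEmpty) = s≤s z≤n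
size-Any ((L , M) ∷ B) (there ne) =
  ≤-trans (size-Any B ne) (≤-trans (m≤n+m (size B) (length L)) (≤-reflexive (sym (length-++ L))))

module NoGap (n : ℕ) (A B : List Col) (ne : All NonEmptyCol A) (empty : All (¬_ ∘ NonEmptyCol) B)
             (wf : All WellFormedCol (A ++ B)) (pos↭ : positions (A ++ B) ↭ range1 n) where

  W : Word
  W = Φ n (A ++ B)

  length-W : length W ≡ n
  length-W = length-readWord n (phiPairs 0 (A ++ B))

  size-A : size A ≡ n
  size-A = begin
    size A                       ≡⟨ sym (+-identityʳ (size A)) ⟩
    size A + 0                   ≡⟨ cong (λ k → size A + length k) (sym (positions-empty B empty)) ⟩
    size A + size B              ≡⟨ sym (size-++ A B) ⟩
    size (A ++ B)                ≡⟨ size-range1 (A ++ B) n pos↭ ⟩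
    n                            ∎
    where open ≡-Reasoning

  d-W : d W ≡ suc (length W)
  d-W = trans (d≡suc W n (≤-reflexive (sym length-W))
      (λ j _ j≤n → Φ-count≤ n A B ne wf pos↭ j (subst (j ≤_) (sym size-A) j≤n))
      (λ n<length → contradiction (subst (n <_) length-W n<length) (<-irrefl refl)))
    (cong suc (sym length-W))

  dropEmpty-≡ : dropEmpty (A ++ B) ≡ A
  dropEmpty-≡ = trans (dropEmpty-++-empty A B empty) (filter-all nonEmptyCol? ne)

module GapAt (n : ℕ) (A B : List Col) (ne : All NonEmptyCol A) (ne′ : Any NonEmptyCol B)
             (wf : All WellFormedCol (A ++ emptyCol ∷ B)) (pos↭ : positions (A ++ emptyCol ∷ B) ↭ range1 n) where

  W : Word
  W = Φ n (A ++ emptyCol ∷ B)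

  length-W : length W ≡ n
  length-W = length-readWord n (phiPairs 0 (A ++ emptyCol ∷ B))

  wf-A : All WellFormedCol A
  wf-A = All.++⁻ˡ A wf

  wf-B : All WellFormedCol B
  wf-B = All.tail (All.++⁻ʳ A wf)

  wf′ : All WellFormedCol (A ++ B)
  wf′ = All.++⁺ wf-A wf-B

  pos↭′ : positions (A ++ B) ↭ range1 n
  pos↭′ = subst (_↭ range1 n) (trans (positions-++ A (emptyCol ∷ B)) (sym (positions-++ A B))) pos↭

  s : ℕ
  s = width A

  s≡size : s ≡ size A
  s≡size = width-nonEmpty A ne

  s<n : s < n
  s<n = begin-strict
    s                   ≡⟨ trans s≡size (sym (+-identityʳ (size A))) ⟩
    size A + 0          <⟨ +-monoʳ-< (size A) (size-Any B ne′) ⟩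
    size A + size B     ≡⟨ sym (size-++ A B) ⟩
    size (A ++ B)       ≡⟨ size-range1 (A ++ B) n pos↭′ ⟩
    n                   ∎
    where open ≤-Reasoning

  letters-≡ : letters 0 (A ++ emptyCol ∷ B) ≡ letters 0 A ++ letters (suc s) B
  letters-≡ = trans (letters-++ 0 A (emptyCol ∷ B)) (cong (λ o → letters 0 A ++ letters o B) (+-comm s 1))

  W↭ : W ↭ letters 0 A ++ letters (suc s) B
  W↭ = subst (W ↭_) letters-≡ (Φ-↭-letters n _ wf pos↭)

  -- All letters of B exceed s + 1, and A has only s letters.
  count≤-gap : count≤ (suc s) W < suc s
  count≤-gap = s≤s (begin
    count≤ (suc s) W                                                      ≡⟨ count≤-↭ (suc s) W↭ ⟩
    count≤ (suc s) (letters 0 A ++ letters (suc s) B)                     ≡⟨ count≤-++ (suc s) (letters 0 A) _ ⟩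
    count≤ (suc s) (letters 0 A) + count≤ (suc s) (letters (suc s) B)    ≡⟨ cong (count≤ (suc s) (letters 0 A) +_) (count≤-all-> (letters-> (suc s) B wf-B)) ⟩
    count≤ (suc s) (letters 0 A) + 0                                      ≡⟨ +-identityʳ _ ⟩
    count≤ (suc s) (letters 0 A)                                          ≤⟨ count≤-≤-length (suc s) (letters 0 A) ⟩
    length (letters 0 A)                                                  ≡⟨ trans (length-letters 0 A wf-A) (sym s≡size) ⟩
    s                                                                     ∎)
    where open ≤-Reasoning

  d-W : d W ≡ suc s
  d-W = d≡suc W s (<⇒≤ s<length)
    (λ j _ j≤s → Φ-count≤ n A (emptyCol ∷ B) ne wf pos↭ j (subst (j ≤_) s≡size j≤s))
    (λ _ → count≤-gap)
    where
    s<length : s < length W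
    s<length = subst (s <_) (sym length-W) s<n

  d≢ : d W ≢ suc (length W)
  d≢ d≡ = <-irrefl (suc-injective (trans (sym d-W) (trans d≡ (cong suc length-W)))) s<n

  lower-≡ : lower (suc s) W ≡ Φ n (A ++ B)
  lower-≡ = trans (lower-readWord (suc s) n (phiPairs 0 (A ++ emptyCol ∷ B))) (cong (readWord n) (begin
    map (map₂ (lowerLetter (suc s))) (phiPairs 0 (A ++ emptyCol ∷ B))
      ≡⟨ cong (map _) (phiPairs-++ 0 A (emptyCol ∷ B)) ⟩
    map (map₂ (lowerLetter (suc s))) (phiPairs 0 A ++ phiPairs (s + 1) B)
      ≡⟨ map-++ _ (phiPairs 0 A) _ ⟩
    map (map₂ (lowerLetter (suc s))) (phiPairs 0 A) ++ map (map₂ (lowerLetter (suc s))) (phiPairs (s + 1) B)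
      ≡⟨ cong₂ _++_ (lowering-below (suc s) (phiPairs 0 A) (All.map m≤n⇒m≤1+n (letters-≤ 0 A wf-A)))
                    (cong (λ o → map (map₂ (lowerLetter (suc s))) (phiPairs o B)) (+-comm s 1)) ⟩
    phiPairs 0 A ++ map (map₂ (lowerLetter (suc s))) (phiPairs (suc s) B)
      ≡⟨ cong (phiPairs 0 A ++_) (lowering-above (suc s) s B ≤-refl wf-B) ⟩
    phiPairs 0 A ++ phiPairs s B
      ≡⟨ sym (phiPairs-++ 0 A B) ⟩
    phiPairs 0 (A ++ B) ∎))
    where open ≡-Reasoning

  sum-< : sum (Φ n (A ++ B)) < sum W
  sum-< = subst (λ w → sum w < sum W) lower-≡ (sum-lower-< (suc s) W (Any-resp-↭ (↭-sym W↭)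
            (Any.++⁺ʳ (letters 0 A) (letters-Any-> (suc s) B wf-B ne′))))

  dropEmpty-≡ : dropEmpty (A ++ B) ≡ dropEmpty (A ++ emptyCol ∷ B)
  dropEmpty-≡ = trans (filter-++ nonEmptyCol? A B) (sym (filter-++ nonEmptyCol? A (emptyCol ∷ B)))

parkF-Φ : ∀ fuel n cs → All WellFormedCol cs → positions cs ↭ range1 n → sum (Φ n cs) < fuel →
          parkF fuel (Φ n cs) ≡ Φ n (dropEmpty cs)
parkF-Φ (suc f) n cs wf pos↭ _ with firstGap cs wf
parkF-Φ (suc f) n _ wf pos↭ _ | noGap A B ne empty = begin
  parkF (suc f) W          ≡⟨ parkF-done f W d-W ⟩
  W                        ≡⟨ Φ-++-empty n A B empty ⟩
  Φ n A                    ≡⟨ cong (Φ n) (sym dropEmpty-≡) ⟩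
  Φ n (dropEmpty (A ++ B)) ∎
  where open ≡-Reasoning
        open NoGap n A B ne empty wf pos↭
parkF-Φ (suc f) n _ wf pos↭ sum<fuel | gapAt A B ne ne′ = begin
  parkF (suc f) W                     ≡⟨ parkF-step f W d≢ ⟩
  parkF f (lower (d W) W)             ≡⟨ cong (λ e → parkF f (lower e W)) d-W ⟩
  parkF f (lower (suc s) W)           ≡⟨ cong (parkF f) lower-≡ ⟩
  parkF f (Φ n (A ++ B))              ≡⟨ parkF-Φ f n (A ++ B) wf′ pos↭′ (<-≤-trans sum-< (≤-pred sum<fuel)) ⟩
  Φ n (dropEmpty (A ++ B))            ≡⟨ cong (Φ n) dropEmpty-≡ ⟩
  Φ n (dropEmpty (A ++ emptyCol ∷ B)) ∎
  where open ≡-Reasoning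
        open GapAt n A B ne ne′ wf pos↭

Park-Φ : ∀ n cs → All WellFormedCol cs → positions cs ↭ range1 n → Park (Φ n cs) ≡ Φ n (dropEmpty cs)
Park-Φ n cs wf pos↭ = parkF-Φ (suc (sum (Φ n cs))) n cs wf pos↭ ≤-refl

-- The r-actions

ValidCol⇒WellFormedCol : ∀ {c} → ValidCol c → WellFormedCol c
ValidCol⇒WellFormedCol (_ , _ , (park , _) , len) = park , len

All-swapIf : ∀ {P : Col → Set} r i cs → All P cs → All P (swapIf r i cs)
All-swapIf r zero (a ∷ b ∷ cs) (pa ∷ pb ∷ ps) with (length (proj₂ a) <ᴿ r) ∨ (length (proj₂ b) <ᴿ r)
... | true  = pb ∷ pa ∷ ps
... | false = pa ∷ pb ∷ ps
All-swapIf r zero [] ps = ps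
All-swapIf r zero (a ∷ []) ps = ps
All-swapIf r (suc i) [] ps = ps
All-swapIf r (suc i) (a ∷ cs) (pa ∷ ps) = pa ∷ All-swapIf r i cs ps

All-pad : ∀ {P : Col → Set} i cs → P emptyCol → All P cs → All P (pad i cs)
All-pad i cs p-empty ps = All.++⁺ ps (All.replicate⁺ _ p-empty)

All-act : ∀ {P : Col → Set} r i cs → P emptyCol → All P cs → All P (act r i cs)
All-act r i cs p-empty ps = All-swapIf r i (pad i cs) (All-pad i cs p-empty ps)

emptyCol-wellFormed : WellFormedCol emptyCol
emptyCol-wellFormed = ([] , _) , refl

-- Under the 1-action only a column with an empty word moves, and for a well-formed
-- column the word is empty exactly when the position set is.
dropEmpty-swapIf-1 : ∀ i cs → All WellFormedCol cs → dropEmpty (swapIf (fin 1) i cs) ≡ dropEmpty cs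
dropEmpty-swapIf-1 zero [] _ = refl
dropEmpty-swapIf-1 zero (a ∷ []) _ = refl
dropEmpty-swapIf-1 zero (([] , _ ∷ _) ∷ b ∷ cs) ((_ , ()) ∷ _)
dropEmpty-swapIf-1 zero ((_ ∷ _ , []) ∷ b ∷ cs) ((_ , ()) ∷ _)
dropEmpty-swapIf-1 zero (a ∷ ([] , _ ∷ _) ∷ cs) (_ ∷ (_ , ()) ∷ _)
dropEmpty-swapIf-1 zero (a ∷ (_ ∷ _ , []) ∷ cs) (_ ∷ (_ , ()) ∷ _)
dropEmpty-swapIf-1 zero (([] , []) ∷ ([] , []) ∷ cs) _ = refl
dropEmpty-swapIf-1 zero (([] , []) ∷ (_ ∷ _ , _ ∷ _) ∷ cs) _ = refl
dropEmpty-swapIf-1 zero ((_ ∷ _ , _ ∷ _) ∷ ([] , []) ∷ cs) _ = refl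
dropEmpty-swapIf-1 zero ((_ ∷ _ , _ ∷ _) ∷ (_ ∷ _ , _ ∷ _) ∷ cs) _ = refl
dropEmpty-swapIf-1 (suc i) [] _ = refl
dropEmpty-swapIf-1 (suc i) (([] , _) ∷ cs) (_ ∷ wf) = dropEmpty-swapIf-1 i cs wf
dropEmpty-swapIf-1 (suc i) ((_ ∷ _ , _) ∷ cs) (_ ∷ wf) = cong (_ ∷_) (dropEmpty-swapIf-1 i cs wf)

dropEmpty-pad : ∀ i cs → dropEmpty (pad i cs) ≡ dropEmpty cs
dropEmpty-pad i cs = dropEmpty-++-empty cs _ (All.replicate⁺ _ (λ ()))

Φ-pad : ∀ n i cs → Φ n (pad i cs) ≡ Φ n cs
Φ-pad n i cs = Φ-++-empty n cs _ (All.replicate⁺ _ (λ ()))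

dropEmpty-act-1 : ∀ i cs → All WellFormedCol cs → dropEmpty (act (fin 1) i cs) ≡ dropEmpty cs
dropEmpty-act-1 i cs wf =
  trans (dropEmpty-swapIf-1 i (pad i cs) (All-pad i cs emptyCol-wellFormed wf)) (dropEmpty-pad i cs)

positions-act-1 : ∀ i cs → All WellFormedCol cs → positions (act (fin 1) i cs) ≡ positions cs
positions-act-1 i cs wf = begin
  positions (act (fin 1) i cs)             ≡⟨ sym (positions-dropEmpty (act (fin 1) i cs)) ⟩
  positions (dropEmpty (act (fin 1) i cs)) ≡⟨ cong positions (dropEmpty-act-1 i cs wf) ⟩
  positions (dropEmpty cs)                 ≡⟨ positions-dropEmpty cs ⟩
  positions cs                             ∎
  where open ≡-Reasoning

_≤ᴿ_ : Rank → Rank → Set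
r ≤ᴿ r′ = ∀ k → T (k <ᴿ r) → T (k <ᴿ r′)

fin≤ᴿfin-suc : ∀ r → fin r ≤ᴿ fin (suc r)
fin≤ᴿfin-suc r k k<r = <⇒<ᵇ (m<n⇒m<1+n (<ᵇ⇒< k r k<r))

fin≤ᴿ∞ : ∀ r → fin r ≤ᴿ ∞
fin≤ᴿ∞ r _ _ = _

swapIf-≤ᴿ : ∀ {r r′} → r ≤ᴿ r′ → ∀ i cs → swapIf r i cs ≡ swapIf r′ i cs ⊎ swapIf r i cs ≡ cs
swapIf-≤ᴿ {r} {r′} r≤r′ zero (a ∷ b ∷ cs)
  with length (proj₂ a) <ᴿ r in short-a | length (proj₂ b) <ᴿ r in short-b
... | true  | _    rewrite Equivalence.to T-≡ (r≤r′ _ (subst T (sym short-a) _)) = inj₁ refl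
... | false | true rewrite Equivalence.to T-≡ (r≤r′ _ (subst T (sym short-b) _)) with length (proj₂ a) <ᴿ r′
...   | true  = inj₁ refl
...   | false = inj₁ refl
swapIf-≤ᴿ r≤r′ zero (a ∷ b ∷ cs) | false | false = inj₂ refl
swapIf-≤ᴿ r≤r′ zero [] = inj₂ refl
swapIf-≤ᴿ r≤r′ zero (a ∷ []) = inj₂ refl
swapIf-≤ᴿ r≤r′ (suc i) [] = inj₂ refl
swapIf-≤ᴿ r≤r′ (suc i) (a ∷ cs) with swapIf-≤ᴿ r≤r′ i cs
... | inj₁ same    = inj₁ (cong (a ∷_) same)
... | inj₂ trivial = inj₂ (cong (a ∷_) trivial)

module _ {c ℓ : Level} (K : Field c ℓ) (n : ℕ) where
  open Field K using (_≈_; reflexive)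

  InPQSymr-1 : ∀ coef → InPQSymr K (fin 1) n coef
  InPQSymr-1 coef m (valid , pos↭) i = reflexive (cong coef (begin
    Park (Φ n (act (fin 1) i m))      ≡⟨ Park-Φ n _ (All-act (fin 1) i m emptyCol-wellFormed wf) pos↭′ ⟩
    Φ n (dropEmpty (act (fin 1) i m)) ≡⟨ cong (Φ n) (dropEmpty-act-1 i m wf) ⟩
    Φ n (dropEmpty m)                 ≡⟨ sym (Park-Φ n m wf pos↭) ⟩
    Park (Φ n m)                      ∎))
    where
    open ≡-Reasoning
    wf : All WellFormedCol m
    wf = All.map ValidCol⇒WellFormedCol valid
    pos↭′ : positions (act (fin 1) i m) ↭ range1 n
    pos↭′ = subst (_↭ range1 n) (sym (positions-act-1 i m wf)) pos↭

  InPQSymr-antitone : ∀ {r r′} → r ≤ᴿ r′ → ∀ coef → InPQSymr K r′ n coef → InPQSymr K r n coef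
  InPQSymr-antitone r≤r′ coef invariant m valid i with swapIf-≤ᴿ r≤r′ i (pad i m)
  ... | inj₁ same    = subst (λ m′ → coef (Park (Φ n m′)) ≈ coef (Park (Φ n m))) (sym same) (invariant m valid i)
  ... | inj₂ trivial = reflexive (cong (coef ∘ Park) (trans (cong (Φ n) trivial) (Φ-pad n i m)))

mainTheorem13 : ∀ {c ℓ : Level} (K : Field c ℓ) → CharZero K →
    ∀ (n : ℕ) →
      (∀ coef → InPQSymr K (fin 1) n coef)
      × (∀ (r : ℕ) → 1 ≤ r → ∀ coef →
           InPQSymr K (fin (suc r)) n coef → InPQSymr K (fin r) n coef)
      × (∀ (r : ℕ) → 1 ≤ r → ∀ coef →
           InPQSymr K ∞ n coef → InPQSymr K (fin r) n coef)
mainTheorem13 K _ n =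
  InPQSymr-1 K n ,
  (λ r _ → InPQSymr-antitone K n (fin≤ᴿfin-suc r)) ,
  (λ r _ → InPQSymr-antitone K n (fin≤ᴿ∞ r))
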